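{- Let $\mathcal{I}$ be any instance of $h$-OVERLAP-COLORING. The coloring produced by Algorithm A and by Algorithm B on $(\mathcal{I},h)$ uses $\chi'_h$ colors, where $$\chi'_h\le\frac{\omega'}{h}+c,$$ $\omega'$ is the clique number of the interval graph of $\mathcal{I}$ (equivalently, the maximum over real $t$ of the number of intervals of $\mathcal{I}$ containing $t$), and $c$ is the minimum number of chains in a partition of $\mathcal{I}$ into chains.
   Context: Two intervals $[x_1,y_1]$ and $[x_2,y_2]$ overlap iff $x_1<x_2<y_1<y_2$ or $x_2<x_1<y_2<y_1$. The $h$-OVERLAP-COLORING problem: given a set $\mathcal{I}=\{I_1,\dots,I_n\}$ of closed intervals $I_i=[x_i,y_i]$ with pairwise distinct endpoints, find a coloring using a minimum number of colors such that (1) overlapping intervals get different colors and (2) for every real $t$ and color $d$, at most $h$ intervals of color $d$ contain $t$. The interval graph of $\mathcal{I}$ has a vertex per interval and an edge between two intervals iff they intersect. A chain is a sequence of intervals $J_1\supseteq J_2\supseteq\dots\supseteq J_m$; $J_1$ is its bottom, $J_m$ its top. A partition of $\mathcal{I}$ into chains is a set of chains such that each interval belongs to exactly one chain. Splitting a chain $J_1\supseteq\dots\supseteq J_m$ into chains of cardinality at most $h$ means forming the chains $J_1,\dots,J_h$; $J_{h+1},\dots,J_{2h}$; etc. Algorithm A (input $\mathcal{I}$, $h$): Step 1: partition $\mathcal{I}$ into a minimum number $c$ of chains. Step 2: split these chains into chains of cardinality at most $h$. Step 3: color the interval graph formed by the bottoms of the resulting chains greedily: process the bottoms in increasing order of starting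 points, reuse a previously used color if one is available (no bottom already having that color intersects the current one), otherwise use a new color; let $\chi'_h$ be the number of colors used. Step 4: give every interval not at the bottom of a chain the color of the bottom of its chain. Algorithm B (input: intervals $I_1,\dots,I_n$ with $x_1<\dots<x_n$, and $h$). Maintain a collection $\mathcal{C}$ of chains (initially empty), a set $\mathcal{D}$ of pairs (color, time) (initially empty), and a counter $\chi=0$. For $i=1,\dots,n$: set bottom $:=$ false. Let $\mathcal{H}$ be the chains in $\mathcal{C}$ whose top interval contains $I_i$. If $\mathcal{H}=\emptyset$, add a new chain consisting of $I_i$ to $\mathcal{C}$ and set bottom $:=$ true. Otherwise let $c_J$ be the chain in $\mathcal{H}$ whose top interval $J=[x_J,y_J]$ has smallest $y_J$; put $I_i$ on top of $c_J$; let $d$ be the color of $J$; if fewer than $h$ intervals of $c_J$ have color $d$, give $I_i$ color $d$, else set bottom $:=$ true. If bottom is true: let $\mathcal{G}=\{(d,y)\in\mathcal{D}:y<x_i\}$; if empty, set $\chi:=\chi+1$, give $I_i$ color $\chi$, add $(\chi,y_i)$ to $\mathcal{D}$; else pick any $(d,y)\in\mathcal{G}$, give $I_i$ color $d$ and replace $(d,y)$ by $(d,y_i)$ in $\mathcal{D}$. The number of colors used is the final value of $\chi$. -}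

module Defs where

open import Data.Nat using (ℕ; zero; suc; _+_; _*_; _≤_; _<_; _≤?_; _<?_; _≟_)
open import Data.Fin as Fin using (Fin; toℕ)
open import Data.Product using (Σ; ∃; _×_; _,_; proj₁; proj₂)
open import Data.Sum using (_⊎_)
open import Data.Empty using (⊥)
open import Data.Unit using (⊤)
open import Data.List using (List; []; _∷_; _++_; [_]; _∷ʳ_; filter; length; allFin; tabulate)
open import Data.List.Membership.Propositional using (_∈_)
open import Data.List.Relation.Unary.All using (All)
open import Data.Vec as Vec using (Vec; _[_]≔_)
open import Relation.Nullary using (¬_; _×-dec_)
open import Relation.Binary.PropositionalEquality using (_≡_; _≢_)

-- Only the relative order of the (pairwise distinct) endpoints matters
-- for every notion below, so natural-number endpoints lose no generality.

Interval : Set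
Interval = ℕ × ℕ

left right : Interval → ℕ
left  = proj₁
right = proj₂

_⊆ᵢ_ : Interval → Interval → Set
I ⊆ᵢ J = left J ≤ left I × right I ≤ right J

Intersect : Interval → Interval → Set
Intersect I J = left I ≤ right J × left J ≤ right I

_∈ᵢ_ : ℕ → Interval → Set
t ∈ᵢ I = left I ≤ t × t ≤ right I

-- Instances: n intervals, indexed in increasing order of starting points
-- (as the input of Algorithm B is), with pairwise distinct endpoints.

ValidInstance : {n : ℕ} → (Fin n → Interval) → Set
ValidInstance {n} I =
    (∀ i → left (I i) < right (I i))
  × (∀ i j → left (I i) ≢ right (I j))
  × (∀ i j → i ≢ j → left (I i) ≢ left (I j))
  × (∀ i j → i ≢ j → right (I i) ≢ right (I j))

SortedByStart : {n : ℕ} → (Fin n → Interval) → Set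
SortedByStart I = ∀ i j → i Fin.< j → left (I i) < left (I j)

depth : {n : ℕ} → (Fin n → Interval) → ℕ → ℕ
depth {n} I t =
  length (filter (λ i → (left (I i) ≤? t) ×-dec (t ≤? right (I i))) (allFin n))

IsMaxDepth : {n : ℕ} → (Fin n → Interval) → ℕ → Set
IsMaxDepth I ω = (∃ λ t → depth I t ≡ ω) × (∀ t → depth I t ≤ ω)

-- Partitions into chains: a labelling of the intervals by k chain labels
-- such that any two intervals with the same label are nested (so each
-- label class is a chain J₁ ⊇ J₂ ⊇ … ⊇ J_m).

Nested : Interval → Interval → Set
Nested I J = I ⊆ᵢ J ⊎ J ⊆ᵢ I

IsChainPartition : {n k : ℕ} → (Fin n → Interval) → (Fin n → Fin k) → Set
IsChainPartition I f = ∀ i j → f i ≡ f j → Nested (I i) (I j)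

IsMinChainCount : {n : ℕ} → (Fin n → Interval) → ℕ → Set
IsMinChainCount {n} I c =
    (Σ (Fin n → Fin c) λ f → IsChainPartition I f)
  × (∀ k (g : Fin n → Fin k) → IsChainPartition I g → c ≤ k)

-- position of interval i in its chain counted from the bottom (0-based):
-- the number of intervals of the same chain strictly containing it.
rank : {n k : ℕ} → (Fin n → Interval) → (Fin n → Fin k) → Fin n → ℕ
rank {n} I f i =
  length (filter (λ j → (f j Fin.≟ f i) ×-dec
                        ((left (I j) <? left (I i)) ×-dec (right (I i) <? right (I j))))
                 (allFin n))

-- after splitting the chains into chains of cardinality at most h
-- (J₁..J_h ; J_{h+1}..J_{2h} ; …), i is a bottom iff its rank is a
-- multiple of h.
IsSplitBottom : {n k : ℕ} → ℕ → (Fin n → Interval) → (Fin n → Fin k) → Fin n → Set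
IsSplitBottom h I f i = ∃ λ q → rank I f i ≡ q * h

-- Greedy colouring (Step 3) of the intervals satisfying `bot`, processed
-- in increasing order of starting points (= index order).  State: the
-- already coloured bottoms with their colours, and the number χ of colours
-- used so far (colours 0 … χ-1).  `GreedyA bot I done χ is χf`: processing
-- the indices `is` from this state may end with χf colours.
data GreedyA {n : ℕ} (bot : Fin n → Set) (I : Fin n → Interval)
     : List (Interval × ℕ) → ℕ → List (Fin n) → ℕ → Set where
  done  : ∀ {cs χ} → GreedyA bot I cs χ [] χ
  skip  : ∀ {cs χ i is χf} → ¬ bot i →
          GreedyA bot I cs χ is χf → GreedyA bot I cs χ (i ∷ is) χf
  reuse : ∀ {cs χ i is χf} → bot i → (d : ℕ) → d < χ →
          (∀ {p} → p ∈ cs → proj₂ p ≡ d → ¬ Intersect (proj₁ p) (I i)) →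
          GreedyA bot I ((I i , d) ∷ cs) χ is χf →
          GreedyA bot I cs χ (i ∷ is) χf
  fresh : ∀ {cs χ i is χf} → bot i →
          (∀ d → d < χ → ∃ λ p → p ∈ cs × proj₂ p ≡ d × Intersect (proj₁ p) (I i)) →
          GreedyA bot I ((I i , χ) ∷ cs) (suc χ) is χf →
          GreedyA bot I cs χ (i ∷ is) χf

-- RunA h I χ : some execution of Algorithm A on (I , h) uses χ colours
-- (= χ'_h).  Step 4 does not change the number of colours.
RunA : {n : ℕ} → ℕ → (Fin n → Interval) → ℕ → Set
RunA {n} h I χ =
  Σ ℕ λ c → Σ (Fin n → Fin c) λ f →
      IsChainPartition I f
    × (∀ k (g : Fin n → Fin k) → IsChainPartition I g → c ≤ k)
    × GreedyA (IsSplitBottom h I f) I [] 0 (allFin n) χ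

-- a chain with its colours, top interval first
Chain : Set
Chain = List (Interval × ℕ)

TopContains : Interval → Chain → Set
TopContains I []             = ⊥
TopContains I ((J , _) ∷ _) = I ⊆ᵢ J

TopRightAtLeast : ℕ → Interval → Chain → Set
TopRightAtLeast r I []             = ⊤
TopRightAtLeast r I ((J , _) ∷ _) = I ⊆ᵢ J → r ≤ right J

countCol : ℕ → Chain → ℕ
countCol d ch = length (filter (λ p → proj₂ p ≟ d) ch)

-- state: chains 𝒞, counter χ, and 𝒟 stored as the vector of times
-- indexed by colour (𝒟 always contains exactly one pair per colour
-- 0 … χ-1).
record StateB : Set where
  constructor st
  field
    chains : List Chain
    χ      : ℕ
    D      : Vec ℕ χ

-- colouring of a new bottom I: result (χ' , D' , colour of I)
data BottomB (I : Interval) : (χ : ℕ) → Vec ℕ χ → (χ' : ℕ) → Vec ℕ χ' → ℕ → Set where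
  fresh : ∀ {χ D} → (∀ (d : Fin χ) → ¬ (Vec.lookup D d < left I)) →
          BottomB I χ D (suc χ) (D Vec.∷ʳ right I) χ
  reuse : ∀ {χ D} (d : Fin χ) → Vec.lookup D d < left I →
          BottomB I χ D χ (D [ d ]≔ right I) (toℕ d)

data StepB (h : ℕ) : StateB → Interval → StateB → Set where
  new      : ∀ {C χ D χ' D' col I} →
             (∀ {ch} → ch ∈ C → ¬ TopContains I ch) →
             BottomB I χ D χ' D' col →
             StepB h (st C χ D) I (st (C ∷ʳ [ (I , col) ]) χ' D')
  extKeep  : ∀ {pre post J d rest χ D I} →
             I ⊆ᵢ J →
             All (TopRightAtLeast (right J) I) (pre ++ post) →
             countCol d ((J , d) ∷ rest) < h →
             StepB h (st (pre ++ ((J , d) ∷ rest) ∷ post) χ D) I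
                     (st (pre ++ ((I , d) ∷ (J , d) ∷ rest) ∷ post) χ D)
  extNew   : ∀ {pre post J d rest χ D χ' D' col I} →
             I ⊆ᵢ J →
             All (TopRightAtLeast (right J) I) (pre ++ post) →
             h ≤ countCol d ((J , d) ∷ rest) →
             BottomB I χ D χ' D' col →
             StepB h (st (pre ++ ((J , d) ∷ rest) ∷ post) χ D) I
                     (st (pre ++ ((I , col) ∷ (J , d) ∷ rest) ∷ post) χ' D')

data RunsB (h : ℕ) : StateB → List Interval → StateB → Set where
  done : ∀ {s} → RunsB h s [] s
  step : ∀ {s s' s'' I Is} → StepB h s I s' → RunsB h s' Is s'' → RunsB h s (I ∷ Is) s''

RunB : {n : ℕ} → ℕ → (Fin n → Interval) → ℕ → Set
RunB h I χ = Σ StateB λ s → RunsB h (st [] 0 Vec.[]) (tabulate I) s × StateB.χ s ≡ χ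

{-# OPTIONS --safe #-}
module Submission where

-- For both algorithms, a new colour is opened at the start t of a bottom only
-- when every colour in use is blocked at t, so it suffices to bound the number
-- of colours blocked at a single point t by (depth t)/h + c.
--
-- In Algorithm A the blocking colours have distinct bottoms containing t.  In a
-- chain K of the minimum partition, the bottoms are the members of rank 0, h,
-- 2h, …, and the members containing t are those of the smallest ranks, so K
-- has at most ⌈m/h⌉ bottoms containing t when m of its members contain t.
--
-- In Algorithm B a colour is blocked at t either because h intervals of that
-- colour contain t (at most (depth t)/h colours), or because it is the colour
-- of the topmost interval containing t of one of B's chains (at most one colour
-- per chain).  B builds at most c chains: by an exchange argument, for every r
-- at most as many of its chains have their top ending by r as there are chains
-- of a minimum partition, restricted to the processed intervals, with that
-- property.

open import Defs
open import Data.Bool using (if_then_else_; true; false)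
open import Data.Nat using (ℕ; suc; _+_; _*_; _≤_; _<_; z≤n; s≤s; _≤?_; _<?_; _≟_; NonZero; >-nonZero)
open import Data.Nat.Properties
open import Algebra.Properties.CommutativeSemigroup +-commutativeSemigroup using () renaming (interchange to +-interchange)
open import Data.Nat.ListAction using (sum)
open import Data.Nat.DivMod using (_/_; m/n*n≤m; m/n*n≡m; /-monoˡ-≤)
open import Data.Nat.Divisibility using (_∣_; divides; _∣?_)
open import Data.Fin as Fin using (Fin; toℕ)
open import Data.Fin.Properties using (toℕ<n; toℕ-injective; toℕ-fromℕ<)
open import Data.Vec as Vec using (Vec; []; _∷_)
open import Data.Vec.Properties using (lookup∘update; lookup∘update′)
open import Data.Product using (∃; _×_; _,_; proj₁; proj₂)
open import Data.Sum using (_⊎_; inj₁; inj₂)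
open import Data.Empty using (⊥-elim)
open import Data.List using (List; []; _∷_; _++_; length; filter; map; concat; concatMap; allFin; upTo)
open import Data.List.Properties using (length-++; filter-++; length-++-sucʳ; map-cong; length-map; length-upTo; length-tabulate; concat-++; concatMap-++; filter-all; ++-identityʳ; map-tabulate)
open import Function using (_∘_; _$_; id)
open import Data.List.Membership.Propositional using (_∈_; _∉_; find; lose)
open import Data.List.Membership.Propositional.Properties using (∈-allFin; ∈-filter⁺; ∈-upTo⁺; ∈-upTo⁻; ∈-map⁺; ∈-concat⁺′; ∈-∃++; ∈-++⁻; ∈-++⁺ˡ; ∈-++⁺ʳ; ∈-map⁻; ∈-filter⁻)
open import Data.List.Relation.Binary.Subset.Propositional using (_⊆_)
open import Data.List.Relation.Binary.Permutation.Propositional using (_↭_; ↭-sym; ↭-trans; ↭-reflexive; module PermutationReasoning)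
import Data.List.Relation.Binary.Permutation.Propositional.Properties as ↭
open ↭ using (∈-resp-↭; ↭-length)
open import Data.List.Relation.Unary.Any as Any using (here; there)
open import Data.List.Relation.Unary.All as All using (All; []; _∷_)
import Data.List.Relation.Unary.All.Properties as AllP
open import Data.List.Relation.Unary.AllPairs as AllPairs using (AllPairs; []; _∷_)
import Data.List.Relation.Unary.AllPairs.Properties as AllPairsₚ
open import Data.List.Relation.Unary.Unique.Propositional using (Unique)
open import Relation.Nullary using (¬_; Dec; yes; no; does; _×-dec_; ¬?)
open import Relation.Unary using (Decidable)
open import Relation.Unary.Properties using (∁?)
import Data.List.Relation.Unary.Unique.Propositional.Properties as Unique
open import Relation.Binary.Definitions using (DecidableEquality)
open import Relation.Binary.PropositionalEquality using (_≡_; _≢_; refl; sym; trans; cong; subst; subst₂; module ≡-Reasoning)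

-- Counting

indicator : {P : Set} → Dec P → ℕ
indicator P? = if does P? then 1 else 0

indicator-yes : {P : Set} (P? : Dec P) → P → indicator P? ≡ 1
indicator-yes (yes _) _  = refl
indicator-yes (no ¬p) p = ⊥-elim (¬p p)

indicator-no : {P : Set} (P? : Dec P) → ¬ P → indicator P? ≡ 0
indicator-no (yes p) ¬p = ⊥-elim (¬p p)
indicator-no (no _)  _  = refl

indicator-×-yesˡ : {P Q : Set} (P? : Dec P) → P → (Q? : Dec Q) → indicator (P? ×-dec Q?) ≡ indicator Q?
indicator-×-yesˡ (yes _) _ _ = refl
indicator-×-yesˡ (no ¬p) p _ = ⊥-elim (¬p p)

module _ {A : Set} where

  length-filter-∷ : {P : A → Set} (P? : Decidable P) (x : A) (xs : List A) →
                    length (filter P? (x ∷ xs)) ≡ indicator (P? x) + length (filter P? xs)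
  length-filter-∷ P? x xs with does (P? x)
  ... | true  = refl
  ... | false = refl

  length-filter-++ : {P : A → Set} (P? : Decidable P) (xs ys : List A) →
                     length (filter P? (xs ++ ys)) ≡ length (filter P? xs) + length (filter P? ys)
  length-filter-++ P? xs ys = trans (cong length (filter-++ P? xs ys)) (length-++ (filter P? xs))

  length-filter-insert : {P : A → Set} (P? : Decidable P) (xs : List A) (y : A) (ys : List A) →
    length (filter P? (xs ++ y ∷ ys)) ≡ indicator (P? y) + length (filter P? (xs ++ ys))
  length-filter-insert P? []       y ys = length-filter-∷ P? y ys
  length-filter-insert P? (x ∷ xs) y ys with does (P? x)
  ... | true  = trans (cong suc (length-filter-insert P? xs y ys)) (sym (+-suc _ _))
  ... | false = length-filter-insert P? xs y ys

  length-filter-mono : {P Q : A → Set} (P? : Decidable P) (Q? : Decidable Q) (xs : List A) →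
                       (∀ {x} → x ∈ xs → P x → Q x) → length (filter P? xs) ≤ length (filter Q? xs)
  length-filter-mono P? Q? []       P⇒Q = z≤n
  length-filter-mono P? Q? (x ∷ xs) P⇒Q with P? x | Q? x
  ... | yes _ | yes _ = s≤s (length-filter-mono P? Q? xs (λ m → P⇒Q (there m)))
  ... | yes p | no ¬q = ⊥-elim (¬q (P⇒Q (here refl) p))
  ... | no _  | yes _ = m≤n⇒m≤1+n (length-filter-mono P? Q? xs (λ m → P⇒Q (there m)))
  ... | no _  | no _  = length-filter-mono P? Q? xs (λ m → P⇒Q (there m))

  length-filter-mono-< : {P Q : A → Set} (P? : Decidable P) (Q? : Decidable Q) (xs : List A) →
                         (∀ {x} → x ∈ xs → P x → Q x) → ∀ {y} → y ∈ xs → Q y → ¬ P y →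
                         length (filter P? xs) < length (filter Q? xs)
  length-filter-mono-< P? Q? (x ∷ xs) P⇒Q (here refl) qx ¬px with P? x | Q? x
  ... | yes px | _     = ⊥-elim (¬px px)
  ... | no _   | yes _ = s≤s (length-filter-mono P? Q? xs (λ m → P⇒Q (there m)))
  ... | no _   | no ¬q = ⊥-elim (¬q qx)
  length-filter-mono-< P? Q? (x ∷ xs) P⇒Q (there y∈xs) qy ¬py with P? x | Q? x
  ... | yes _  | yes _ = s≤s (length-filter-mono-< P? Q? xs (λ m → P⇒Q (there m)) y∈xs qy ¬py)
  ... | yes px | no ¬q = ⊥-elim (¬q (P⇒Q (here refl) px))
  ... | no _   | yes _ = m≤n⇒m≤1+n (length-filter-mono-< P? Q? xs (λ m → P⇒Q (there m)) y∈xs qy ¬py)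
  ... | no _   | no _  = length-filter-mono-< P? Q? xs (λ m → P⇒Q (there m)) y∈xs qy ¬py

  Unique-⊆⇒length≤ : {xs ys : List A} → Unique xs → xs ⊆ ys → length xs ≤ length ys
  Unique-⊆⇒length≤ {[]}     _            _     = z≤n
  Unique-⊆⇒length≤ {x ∷ xs} (x∉xs ∷ xs!) xs⊆ys with ∈-∃++ (xs⊆ys (here refl))
  ... | ys₁ , ys₂ , refl =
    subst (suc (length xs) ≤_) (sym (length-++-sucʳ ys₁ x ys₂)) (s≤s (Unique-⊆⇒length≤ xs! xs⊆ys₁++ys₂))
    where
    xs⊆ys₁++ys₂ : xs ⊆ ys₁ ++ ys₂
    xs⊆ys₁++ys₂ y∈xs with ∈-++⁻ ys₁ (xs⊆ys (there y∈xs))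
    ... | inj₁ y∈ys₁          = ∈-++⁺ˡ y∈ys₁
    ... | inj₂ (here refl)    = ⊥-elim (All.lookup x∉xs y∈xs refl)
    ... | inj₂ (there y∈ys₂) = ∈-++⁺ʳ ys₁ y∈ys₂

  length≤filter+⊆ : {P : A → Set} (P? : Decidable P) {xs ys : List A} → Unique xs →
                    (∀ {x} → x ∈ xs → ¬ P x → x ∈ ys) → length xs ≤ length (filter P? xs) + length ys
  length≤filter+⊆ P? {xs} {ys} xs! ¬P⇒∈ys = begin
    length xs                                           ≡⟨ sym (length-filter+length-filter-∁ xs) ⟩
    length (filter P? xs) + length (filter (∁? P?) xs)  ≤⟨ +-monoʳ-≤ (length (filter P? xs)) rest⊆ys ⟩
    length (filter P? xs) + length ys                   ∎
    where
    open ≤-Reasoning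
    length-filter+length-filter-∁ : ∀ xs → length (filter P? xs) + length (filter (∁? P?) xs) ≡ length xs
    length-filter+length-filter-∁ []       = refl
    length-filter+length-filter-∁ (x ∷ xs) with does (P? x)
    ... | true  = cong suc (length-filter+length-filter-∁ xs)
    ... | false = trans (+-suc _ _) (cong suc (length-filter+length-filter-∁ xs))
    rest⊆ys = Unique-⊆⇒length≤ (Unique.filter⁺ (∁? P?) xs!)
                (λ m → let x∈xs , ¬px = ∈-filter⁻ (∁? P?) m in ¬P⇒∈ys x∈xs ¬px)

  length-filter≤filter+indicator : {P Q : A → Set} (P? : Decidable P) (Q? : Decidable Q) (y : A) {xs : List A} →
    Unique xs → (∀ {x} → x ∈ xs → P x → Q x ⊎ x ≡ y) → length (filter P? xs) ≤ length (filter Q? xs) + indicator (P? y)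
  length-filter≤filter+indicator P? Q? y {[]}     _            _         = z≤n
  length-filter≤filter+indicator {Q = Q} P? Q? y {x ∷ xs} (x∉xs ∷ xs!) P⇒Q⊎≡y with P? x | Q? x
  ... | no _  | yes _ = m≤n⇒m≤1+n (length-filter≤filter+indicator P? Q? y xs! (λ m → P⇒Q⊎≡y (there m)))
  ... | no _  | no _  = length-filter≤filter+indicator P? Q? y xs! (λ m → P⇒Q⊎≡y (there m))
  ... | yes _ | yes _ = s≤s (length-filter≤filter+indicator P? Q? y xs! (λ m → P⇒Q⊎≡y (there m)))
  ... | yes px | no ¬qx with P⇒Q⊎≡y (here refl) px
  ...   | inj₁ qx   = ⊥-elim (¬qx qx)
  ...   | inj₂ refl rewrite indicator-yes (P? x) px =
    subst (_≤ length (filter Q? xs) + 1) (+-comm (length (filter P? xs)) 1)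
      (+-monoˡ-≤ 1 (length-filter-mono P? Q? xs (λ {z} z∈xs pz → Q-of z∈xs (P⇒Q⊎≡y (there z∈xs) pz))))
    where
    Q-of : ∀ {z} → z ∈ xs → Q z ⊎ z ≡ x → Q z
    Q-of _    (inj₁ qz)  = qz
    Q-of z∈xs (inj₂ refl) = ⊥-elim (All.lookup x∉xs z∈xs refl)

  map⁺-injectiveOn : {B : Set} (f : A → B) {xs : List A} →
                     (∀ {x y} → x ∈ xs → y ∈ xs → f x ≡ f y → x ≡ y) → Unique xs → Unique (map f xs)
  map⁺-injectiveOn f {[]}     _   _            = []
  map⁺-injectiveOn f {x ∷ xs} inj (x∉xs ∷ xs!) =
    All.tabulate (λ fy∈ fx≡fy → let y , y∈xs , fy≡ = ∈-map⁻ f fy∈ in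
                   All.lookup x∉xs y∈xs (inj (here refl) (there y∈xs) (trans fx≡fy fy≡)))
    ∷ map⁺-injectiveOn f (λ x∈ y∈ → inj (there x∈) (there y∈)) xs!

  sum-map-+ : (g k : A → ℕ) (xs : List A) → sum (map (λ x → g x + k x) xs) ≡ sum (map g xs) + sum (map k xs)
  sum-map-+ g k []       = refl
  sum-map-+ g k (x ∷ xs) rewrite sum-map-+ g k xs = +-interchange (g x) (k x) _ _

  sum-map-mono : (g k : A → ℕ) (xs : List A) → (∀ {x} → x ∈ xs → g x ≤ k x) → sum (map g xs) ≤ sum (map k xs)
  sum-map-mono g k []       _   = z≤n
  sum-map-mono g k (x ∷ xs) g≤k = +-mono-≤ (g≤k (here refl)) (sum-map-mono g k xs (λ m → g≤k (there m)))

  sum-map-* : (c : ℕ) (g : A → ℕ) (xs : List A) → sum (map (λ x → c * g x) xs) ≡ c * sum (map g xs)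
  sum-map-* c g []       = sym (*-zeroʳ c)
  sum-map-* c g (x ∷ xs) = trans (cong (c * g x +_) (sum-map-* c g xs)) (sym (*-distribˡ-+ c (g x) _))

  sum-map-const : (c : ℕ) (xs : List A) → sum (map (λ _ → c) xs) ≡ length xs * c
  sum-map-const c []       = refl
  sum-map-const c (x ∷ xs) = cong (c +_) (sum-map-const c xs)

∈⇒≤sum : ∀ {x xs} → x ∈ xs → x ≤ sum xs
∈⇒≤sum {xs = y ∷ xs} (here refl)  = m≤m+n y (sum xs)
∈⇒≤sum {xs = y ∷ xs} (there x∈xs) = ≤-trans (∈⇒≤sum x∈xs) (m≤n+m (sum xs) y)

module _ {K : Set} (_≟ₖ_ : DecidableEquality K) where

  sum-indicator-≟≤1 : (a : K) {ks : List K} → Unique ks → sum (map (λ k → indicator (a ≟ₖ k)) ks) ≤ 1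
  sum-indicator-≟≤1 a {[]}     _          = z≤n
  sum-indicator-≟≤1 a {k ∷ ks} (k∉ks ∷ ks!) with a ≟ₖ k
  ... | no _     = sum-indicator-≟≤1 a ks!
  ... | yes refl = ≤-reflexive (cong suc (sum-indicator-∉ ks (λ a∈ks → All.lookup k∉ks a∈ks refl)))
    where
    sum-indicator-∉ : ∀ ks → a ∉ ks → sum (map (λ k → indicator (a ≟ₖ k)) ks) ≡ 0
    sum-indicator-∉ []       _    = refl
    sum-indicator-∉ (k ∷ ks) a∉ks rewrite indicator-no (a ≟ₖ k) (λ a≡k → a∉ks (here a≡k)) =
      sum-indicator-∉ ks (λ a∈ks → a∉ks (there a∈ks))

  sum-indicator-≟-∈ : (a : K) {ks : List K} → a ∈ ks → 1 ≤ sum (map (λ k → indicator (a ≟ₖ k)) ks)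
  sum-indicator-≟-∈ a {k ∷ ks} (here refl) rewrite indicator-yes (a ≟ₖ a) refl = s≤s z≤n
  sum-indicator-≟-∈ a {k ∷ ks} (there a∈ks) = ≤-trans (sum-indicator-≟-∈ a a∈ks) (m≤n+m _ _)

  module _ {A : Set} (key : A → K) {P : A → Set} (P? : Decidable P) where

    countWithKey : K → List A → ℕ
    countWithKey k = length ∘ filter (λ x → P? x ×-dec (key x ≟ₖ k))

    private
      sum-countWithKey-∷ : ∀ (ks : List K) x xs →
        sum (map (λ k → countWithKey k (x ∷ xs)) ks) ≡
        sum (map (λ k → indicator (P? x ×-dec (key x ≟ₖ k))) ks) + sum (map (λ k → countWithKey k xs) ks)
      sum-countWithKey-∷ ks x xs =
        trans (cong sum (map-cong (λ k → length-filter-∷ (λ y → P? y ×-dec (key y ≟ₖ k)) x xs) ks))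
              (sum-map-+ _ _ ks)

      sum-zeros : ∀ (ks : List K) → sum (map (λ _ → 0) ks) ≡ 0
      sum-zeros ks = trans (sum-map-const 0 ks) (*-zeroʳ (length ks))

    sum-countWithKey≤ : {ks : List K} → Unique ks → ∀ xs →
                        sum (map (λ k → countWithKey k xs) ks) ≤ length (filter P? xs)
    sum-countWithKey≤ {ks} ks! []       = ≤-reflexive (sum-zeros ks)
    sum-countWithKey≤ {ks} ks! (x ∷ xs)
      rewrite sum-countWithKey-∷ ks x xs | length-filter-∷ P? x xs =
      +-mono-≤ (head x) (sum-countWithKey≤ ks! xs)
      where
      head : ∀ x → sum (map (λ k → indicator (P? x ×-dec (key x ≟ₖ k))) ks) ≤ indicator (P? x)
      head x with P? x
      ... | yes _ = sum-indicator-≟≤1 (key x) ks!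
      ... | no _  = ≤-reflexive (sum-zeros ks)

    length-filter≤sum-countWithKey : {ks : List K} → (∀ x → key x ∈ ks) → ∀ xs →
                                     length (filter P? xs) ≤ sum (map (λ k → countWithKey k xs) ks)
    length-filter≤sum-countWithKey {ks} _      []       = z≤n
    length-filter≤sum-countWithKey {ks} keys∈ (x ∷ xs)
      rewrite sum-countWithKey-∷ ks x xs | length-filter-∷ P? x xs =
      +-mono-≤ (head x) (length-filter≤sum-countWithKey keys∈ xs)
      where
      head : ∀ x → indicator (P? x) ≤ sum (map (λ k → indicator (P? x ×-dec (key x ≟ₖ k))) ks)
      head x with P? x
      ... | yes _ = sum-indicator-≟-∈ (key x) (keys∈ x)
      ... | no _  = z≤n

-- Intervals and chain partitions

_∈ᵢ?_ : (t : ℕ) (J : Interval) → Dec (t ∈ᵢ J)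
t ∈ᵢ? J = (left J ≤? t) ×-dec (t ≤? right J)

∈ᵢ-⊆ᵢ : ∀ {t J K} → t ∈ᵢ J → J ⊆ᵢ K → t ∈ᵢ K
∈ᵢ-⊆ᵢ (lJ≤t , t≤rJ) (lK≤lJ , rJ≤rK) = ≤-trans lK≤lJ lJ≤t , ≤-trans t≤rJ rJ≤rK

⊆ᵢ-trans : ∀ {J K L} → J ⊆ᵢ K → K ⊆ᵢ L → J ⊆ᵢ L
⊆ᵢ-trans (lK≤lJ , rJ≤rK) (lL≤lK , rK≤rL) = ≤-trans lL≤lK lK≤lJ , ≤-trans rJ≤rK rK≤rL

module Instance {n : ℕ} (I : Fin n → Interval) (valid : ValidInstance I) where

  left∈ᵢ : ∀ i → left (I i) ∈ᵢ I i
  left∈ᵢ i = ≤-refl , <⇒≤ (proj₁ valid i)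

  ⊆ᵢ⇒strict : ∀ {i j} → i ≢ j → I i ⊆ᵢ I j → left (I j) < left (I i) × right (I i) < right (I j)
  ⊆ᵢ⇒strict {i} {j} i≢j (lj≤li , ri≤rj) =
    ≤∧≢⇒< lj≤li (proj₁ (proj₂ (proj₂ valid)) j i (i≢j ∘ sym)) ,
    ≤∧≢⇒< ri≤rj (proj₂ (proj₂ (proj₂ valid)) i j i≢j)

  module ChainPartition {c : ℕ} (f : Fin n → Fin c) (part : IsChainPartition I f) where

    -- Oriented as in the definition of rank: rank I f i counts the j with i ⊏ j.
    _⊏_ : Fin n → Fin n → Set
    i ⊏ j = f j ≡ f i × (left (I j) < left (I i) × right (I i) < right (I j))

    _⊏?_ : ∀ i j → Dec (i ⊏ j)
    i ⊏? j = (f j Fin.≟ f i) ×-dec ((left (I j) <? left (I i)) ×-dec (right (I i) <? right (I j)))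

    ⊏-irrefl : ∀ {i} → ¬ i ⊏ i
    ⊏-irrefl (_ , l<l , _) = <-irrefl refl l<l

    sameChain⇒⊏⊎⊐ : ∀ {i j} → i ≢ j → f i ≡ f j → i ⊏ j ⊎ j ⊏ i
    sameChain⇒⊏⊎⊐ {i} {j} i≢j fi≡fj with part i j fi≡fj
    ... | inj₁ Ii⊆Ij = inj₁ (sym fi≡fj , ⊆ᵢ⇒strict i≢j Ii⊆Ij)
    ... | inj₂ Ij⊆Ii = inj₂ (fi≡fj , ⊆ᵢ⇒strict (i≢j ∘ sym) Ij⊆Ii)

    rank-⊏ : ∀ {i j} → i ⊏ j → rank I f j < rank I f i
    rank-⊏ {i} {j} (fj≡fi , lj<li , ri<rj) =
      length-filter-mono-< (j ⊏?_) (i ⊏?_) (allFin n)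
        (λ _ (fk≡fj , lk<lj , rj<rk) → trans fk≡fj fj≡fi , <-trans lk<lj lj<li , <-trans ri<rj rj<rk)
        (∈-allFin j) (fj≡fi , lj<li , ri<rj) ⊏-irrefl

    rank-injective : ∀ {i j} → f i ≡ f j → rank I f i ≡ rank I f j → i ≡ j
    rank-injective {i} {j} fi≡fj ri≡rj with i Fin.≟ j
    ... | yes i≡j = i≡j
    ... | no i≢j with sameChain⇒⊏⊎⊐ i≢j fi≡fj
    ...   | inj₁ i⊏j = ⊥-elim (<-irrefl (sym ri≡rj) (rank-⊏ i⊏j))
    ...   | inj₂ j⊏i = ⊥-elim (<-irrefl ri≡rj (rank-⊏ j⊏i))

-- Algorithm A

module AlgorithmA {n : ℕ} (I : Fin n → Interval) (valid : ValidInstance I)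
                  (h : ℕ) .{{_ : NonZero h}} {c : ℕ} (f : Fin n → Fin c) (part : IsChainPartition I f) where
  open Instance I valid
  open ChainPartition f part

  Bottom : Fin n → Set
  Bottom j = h ∣ rank I f j

  splitBottom⇒Bottom : ∀ {j} → IsSplitBottom h I f j → Bottom j
  splitBottom⇒Bottom (q , rank≡q*h) = divides q rank≡q*h

  bottomAt? : (t : ℕ) → Decidable (λ j → Bottom j × t ∈ᵢ I j)
  bottomAt? t j = (h ∣? rank I f j) ×-dec (t ∈ᵢ? I j)

  bottomsAt : ℕ → ℕ
  bottomsAt t = length (filter (bottomAt? t) (allFin n))

  chainBottomsAt chainMembersAt : ℕ → Fin c → ℕ
  chainBottomsAt t K = countWithKey Fin._≟_ f (bottomAt? t) K (allFin n)
  chainMembersAt t K = countWithKey Fin._≟_ f (t ∈ᵢ?_ ∘ I) K (allFin n)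

  rank<chainMembersAt : ∀ {t j} → t ∈ᵢ I j → rank I f j < chainMembersAt t (f j)
  rank<chainMembersAt {t} {j} t∈Ij =
    length-filter-mono-< (j ⊏?_) (λ k → (t ∈ᵢ? I k) ×-dec (f k Fin.≟ f j)) (allFin n)
      (λ _ (fk≡fj , lk<lj , rj<rk) → ∈ᵢ-⊆ᵢ t∈Ij (<⇒≤ lk<lj , <⇒≤ rj<rk) , fk≡fj)
      (∈-allFin j) (t∈Ij , refl) ⊏-irrefl

  -- The bottoms of chain K at t have distinct ranks, all multiples of h and
  -- smaller than the number of members of K at t.
  h*chainBottomsAt≤ : ∀ t K → h * chainBottomsAt t K ≤ chainMembersAt t K + h
  h*chainBottomsAt≤ t K = begin
    h * chainBottomsAt t K          ≡⟨ cong (h *_) (sym (length-map quotient bottoms)) ⟩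
    h * length (map quotient bottoms) ≤⟨ *-monoʳ-≤ h (Unique-⊆⇒length≤ quotients! quotients⊆) ⟩
    h * length (upTo (suc (m / h))) ≡⟨ cong (h *_) (length-upTo (suc (m / h))) ⟩
    h * suc (m / h)                 ≡⟨ *-suc h (m / h) ⟩
    h + h * (m / h)                 ≡⟨ cong (h +_) (*-comm h (m / h)) ⟩
    h + m / h * h                   ≤⟨ +-monoʳ-≤ h (m/n*n≤m m h) ⟩
    h + m                           ≡⟨ +-comm h m ⟩
    m + h                           ∎
    where
    open ≤-Reasoning
    m = chainMembersAt t K
    bottoms = filter (λ j → bottomAt? t j ×-dec (f j Fin.≟ K)) (allFin n)
    quotient : Fin n → ℕ
    quotient j = rank I f j / h
    member : ∀ {j} → j ∈ bottoms → (Bottom j × t ∈ᵢ I j) × f j ≡ K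
    member j∈ = proj₂ (∈-filter⁻ (λ j → bottomAt? t j ×-dec (f j Fin.≟ K)) {xs = allFin n} j∈)
    quotients! : Unique (map quotient bottoms)
    quotients! = map⁺-injectiveOn quotient
      (λ {j} {k} j∈ k∈ qj≡qk →
        let (bj , _) , fj≡K = member j∈ ; (bk , _) , fk≡K = member k∈ in
        rank-injective (trans fj≡K (sym fk≡K))
          (trans (sym (m/n*n≡m bj)) (trans (cong (_* h) qj≡qk) (m/n*n≡m bk))))
      (Unique.filter⁺ _ (Unique.allFin⁺ n))
    quotients⊆ : map quotient bottoms ⊆ upTo (suc (m / h))
    quotients⊆ q∈ with ∈-map⁻ quotient q∈
    ... | j , j∈ , refl with member j∈
    ...   | (_ , t∈Ij) , refl = ∈-upTo⁺ (s≤s (/-monoˡ-≤ h (<⇒≤ (rank<chainMembersAt t∈Ij))))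

  h*bottomsAt≤ : ∀ t → h * bottomsAt t ≤ depth I t + h * c
  h*bottomsAt≤ t = begin
    h * bottomsAt t                                      ≤⟨ *-monoʳ-≤ h
      (length-filter≤sum-countWithKey Fin._≟_ f (bottomAt? t) (∈-allFin ∘ f) (allFin n)) ⟩
    h * sum (map (chainBottomsAt t) Ks)                  ≡⟨ sym (sum-map-* h (chainBottomsAt t) Ks) ⟩
    sum (map (λ K → h * chainBottomsAt t K) Ks)          ≤⟨ sum-map-mono _ _ Ks (λ {K} _ → h*chainBottomsAt≤ t K) ⟩
    sum (map (λ K → chainMembersAt t K + h) Ks)          ≡⟨ sum-map-+ (chainMembersAt t) (λ _ → h) Ks ⟩
    sum (map (chainMembersAt t) Ks) + sum (map (λ _ → h) Ks)
      ≤⟨ +-mono-≤ (sum-countWithKey≤ Fin._≟_ f (t ∈ᵢ?_ ∘ I) (Unique.allFin⁺ c) (allFin n))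
                  (≤-reflexive (trans (sum-map-const h Ks) (cong (_* h) (length-tabulate {n = c} id)))) ⟩
    depth I t + c * h                                    ≡⟨ cong (depth I t +_) (*-comm c h) ⟩
    depth I t + h * c                                    ∎
    where
    open ≤-Reasoning
    Ks = allFin c

  module _ {ω : ℕ} (depth≤ω : ∀ t → depth I t ≤ ω) where

    record GreedyInvariant (cs : List (Interval × ℕ)) (χ : ℕ) (is : List (Fin n)) : Set where
      field
        coloured-bottom   : ∀ {p} → p ∈ cs → ∃ λ j → Bottom j × proj₁ p ≡ I j
        coloured-earlier  : ∀ {p} → p ∈ cs → All (λ i → left (proj₁ p) < left (I i)) is
        colour-functional : ∀ {p q} → p ∈ cs → q ∈ cs → proj₁ p ≡ proj₁ q → proj₂ p ≡ proj₂ q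
        pending-sorted    : AllPairs (λ i j → left (I i) < left (I j)) is
        colours-bounded   : h * χ ≤ ω + h * c

    open GreedyInvariant

    skipInvariant : ∀ {cs χ i is} → GreedyInvariant cs χ (i ∷ is) → GreedyInvariant cs χ is
    skipInvariant inv = record
      { coloured-bottom   = coloured-bottom inv
      ; coloured-earlier  = All.tail ∘ coloured-earlier inv
      ; colour-functional = colour-functional inv
      ; pending-sorted    = AllPairs.tail (pending-sorted inv)
      ; colours-bounded   = colours-bounded inv
      }

    colourInvariant : ∀ {cs χ i is} → GreedyInvariant cs χ (i ∷ is) → Bottom i →
                      (d : ℕ) {χ′ : ℕ} → h * χ′ ≤ ω + h * c → GreedyInvariant ((I i , d) ∷ cs) χ′ is
    colourInvariant {cs} {χ} {i} {is} inv bottom d bounded = record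
      { coloured-bottom   = λ { (here refl) → i , bottom , refl ; (there p∈) → coloured-bottom inv p∈ }
      ; coloured-earlier  = λ { (here refl) → AllPairs.head (pending-sorted inv)
                              ; (there p∈)  → All.tail (coloured-earlier inv p∈) }
      ; colour-functional = functional
      ; pending-sorted    = AllPairs.tail (pending-sorted inv)
      ; colours-bounded   = bounded
      }
      where
      older : ∀ {p} → p ∈ cs → proj₁ p ≢ I i
      older p∈ p≡Ii = <-irrefl (cong left p≡Ii) (All.head (coloured-earlier inv p∈))
      functional : ∀ {p q} → p ∈ (I i , d) ∷ cs → q ∈ (I i , d) ∷ cs → proj₁ p ≡ proj₁ q → proj₂ p ≡ proj₂ q
      functional (here refl) (here refl) _     = refl
      functional (here refl) (there q∈)  Ii≡q = ⊥-elim (older q∈ (sym Ii≡q))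
      functional (there p∈)  (here refl) p≡Ii = ⊥-elim (older p∈ p≡Ii)
      functional (there p∈)  (there q∈)  p≡q  = colour-functional inv p∈ q∈ p≡q

    -- Distinct colours give distinct bottoms since the colour of a bottom is a function of its interval.
    blocking-bottoms : ∀ {cs χ i is} → GreedyInvariant cs χ (i ∷ is) →
      (∀ d → d < χ → ∃ λ p → p ∈ cs × proj₂ p ≡ d × Intersect (proj₁ p) (I i)) →
      ∃ λ (w : Fin χ → Fin n) → (∀ {d e} → w d ≡ w e → d ≡ e) ×
                                (∀ d → Bottom (w d) × left (I (w d)) < left (I i) × left (I i) ≤ right (I (w d)))
    blocking-bottoms {cs} {χ} {i} inv blocked = witness , witness-injective , λ d →
      let p∈ = blocker∈ d ; _ , bottom , p≡ = coloured-bottom inv p∈ ; _ , _ , _ , meets = blocked (toℕ d) (toℕ<n d) in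
      bottom , subst (λ J → left J < left (I i)) p≡ (All.head (coloured-earlier inv p∈)) ,
      subst (λ J → left (I i) ≤ right J) p≡ (proj₂ meets)
      where
      blocker∈ : ∀ d → proj₁ (blocked (toℕ d) (toℕ<n d)) ∈ cs
      blocker∈ d = proj₁ (proj₂ (blocked (toℕ d) (toℕ<n d)))
      witness : Fin χ → Fin n
      witness d = proj₁ (coloured-bottom inv (blocker∈ d))
      witness-injective : ∀ {d e} → witness d ≡ witness e → d ≡ e
      witness-injective {d} {e} wd≡we = toℕ-injective (begin
        toℕ d                                  ≡⟨ sym (proj₁ (proj₂ (proj₂ (blocked (toℕ d) (toℕ<n d))))) ⟩
        proj₂ (proj₁ (blocked (toℕ d) _))      ≡⟨ colour-functional inv (blocker∈ d) (blocker∈ e)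
                                                    (trans (source d) (trans (cong I wd≡we) (sym (source e)))) ⟩
        proj₂ (proj₁ (blocked (toℕ e) _))      ≡⟨ proj₁ (proj₂ (proj₂ (blocked (toℕ e) (toℕ<n e)))) ⟩
        toℕ e                                  ∎)
        where
        open ≡-Reasoning
        source : ∀ d → proj₁ (proj₁ (blocked (toℕ d) (toℕ<n d))) ≡ I (witness d)
        source d = proj₂ (proj₂ (coloured-bottom inv (blocker∈ d)))

    fresh⇒suc≤bottomsAt : ∀ {cs χ i is} → GreedyInvariant cs χ (i ∷ is) → Bottom i →
      (∀ d → d < χ → ∃ λ p → p ∈ cs × proj₂ p ≡ d × Intersect (proj₁ p) (I i)) →
      suc χ ≤ bottomsAt (left (I i))
    fresh⇒suc≤bottomsAt {χ = χ} {i} inv bottom blocked with blocking-bottoms inv blocked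
    ... | w , w-injective , w-bottom =
      subst (_≤ bottomsAt (left (I i))) (cong suc (trans (length-map w (allFin χ)) (length-tabulate {n = χ} id)))
        (Unique-⊆⇒length≤ bottoms! bottoms⊆)
      where
      bottoms! : Unique (i ∷ map w (allFin χ))
      bottoms! = All.tabulate (λ w∈ i≡w → let d , _ , w≡ = ∈-map⁻ w w∈ in
                   <-irrefl (cong (left ∘ I) (sym (trans i≡w w≡))) (proj₁ (proj₂ (w-bottom d))))
               ∷ map⁺-injectiveOn w (λ _ _ → w-injective) (Unique.allFin⁺ χ)
      bottoms⊆ : i ∷ map w (allFin χ) ⊆ filter (bottomAt? (left (I i))) (allFin n)
      bottoms⊆ (here refl) = ∈-filter⁺ (bottomAt? _) (∈-allFin i) (bottom , left∈ᵢ i)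
      bottoms⊆ (there w∈) with ∈-map⁻ w w∈
      ... | d , _ , refl = let bottom-d , earlier , reaches = w-bottom d in
        ∈-filter⁺ (bottomAt? _) (∈-allFin (w d)) (bottom-d , <⇒≤ earlier , reaches)

    greedy-bounded : ∀ {cs χ is χf} → GreedyA (IsSplitBottom h I f) I cs χ is χf →
                   GreedyInvariant cs χ is → h * χf ≤ ω + h * c
    greedy-bounded done                        inv = colours-bounded inv
    greedy-bounded (skip _ run)                inv = greedy-bounded run (skipInvariant inv)
    greedy-bounded (reuse bottom d _ _ run)    inv =
      greedy-bounded run (colourInvariant inv (splitBottom⇒Bottom bottom) d (colours-bounded inv))
    greedy-bounded (fresh {χ = χ} {i = i} bottom blocked run) inv =
      greedy-bounded run (colourInvariant inv (splitBottom⇒Bottom bottom) χ (begin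
        h * suc χ                       ≤⟨ *-monoʳ-≤ h (fresh⇒suc≤bottomsAt inv (splitBottom⇒Bottom bottom) blocked) ⟩
        h * bottomsAt (left (I i))      ≤⟨ h*bottomsAt≤ (left (I i)) ⟩
        depth I (left (I i)) + h * c    ≤⟨ +-monoˡ-≤ (h * c) (depth≤ω (left (I i))) ⟩
        ω + h * c                       ∎))
      where open ≤-Reasoning

    runA-bounded : SortedByStart I → ∀ {χ} → GreedyA (IsSplitBottom h I f) I [] 0 (allFin n) χ → h * χ ≤ ω + h * c
    runA-bounded sorted run = greedy-bounded run (record
      { coloured-bottom   = λ ()
      ; coloured-earlier  = λ ()
      ; colour-functional = λ ()
      ; pending-sorted    = AllPairsₚ.tabulate⁺-< (sorted _ _)
      ; colours-bounded   = subst (_≤ ω + h * c) (sym (*-zeroʳ h)) z≤n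
      })

-- Coloured chains, as maintained by Algorithm B

Entry : Set
Entry = Interval × ℕ

Descending : Chain → Set
Descending = AllPairs (λ e e′ → proj₁ e ⊆ᵢ proj₁ e′)

descending-∷ : ∀ {K col J d rest} → Descending ((J , d) ∷ rest) → K ⊆ᵢ J →
               Descending ((K , col) ∷ (J , d) ∷ rest)
descending-∷ desc@(J⊆rest ∷ _) K⊆J = (K⊆J ∷ All.map (⊆ᵢ-trans K⊆J) J⊆rest) ∷ desc

descending⇒∈ᵢ : ∀ {t J d rest} → Descending ((J , d) ∷ rest) → t ∈ᵢ J → All (λ e → t ∈ᵢ proj₁ e) ((J , d) ∷ rest)
descending⇒∈ᵢ (J⊆rest ∷ _) t∈J = t∈J ∷ All.map (∈ᵢ-⊆ᵢ t∈J) J⊆rest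

descending-insert : ∀ pre post {K col J d₀ rest} → All Descending (pre ++ ((J , d₀) ∷ rest) ∷ post) → K ⊆ᵢ J →
                    All Descending (pre ++ ((K , col) ∷ (J , d₀) ∷ rest) ∷ post)
descending-insert pre post desc K⊆J with AllP.++⁻ pre desc
... | desc-pre , desc-J ∷ desc-post = AllP.++⁺ desc-pre (descending-∷ desc-J K⊆J ∷ desc-post)

topRight : Chain → ℕ
topRight []            = 0
topRight ((J , _) ∷ _) = right J

chainTopsBy : List Chain → ℕ → ℕ
chainTopsBy C r = length (filter (λ ch → topRight ch ≤? r) C)

entryDepth : ℕ → List Chain → ℕ
entryDepth t C = length (filter (λ e → t ∈ᵢ? proj₁ e) (concat C))

colourDepth : ℕ → ℕ → List Chain → ℕ
colourDepth k t C = countWithKey _≟_ proj₂ (λ e → t ∈ᵢ? proj₁ e) k (concat C)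

topColourAt : ℕ → Chain → List ℕ
topColourAt t []             = []
topColourAt t ((J , d) ∷ ch) with t ∈ᵢ? J
... | yes _ = d ∷ []
... | no _  = topColourAt t ch

topColoursAt : ℕ → List Chain → List ℕ
topColoursAt t = concatMap (topColourAt t)

topColourAt-∈ᵢ : ∀ {t J} d ch → t ∈ᵢ J → topColourAt t ((J , d) ∷ ch) ≡ d ∷ []
topColourAt-∈ᵢ {t} {J} d ch t∈J with t ∈ᵢ? J
... | yes _   = refl
... | no t∉J = ⊥-elim (t∉J t∈J)

length-topColourAt : ∀ t ch → length (topColourAt t ch) ≤ 1
length-topColourAt t []             = z≤n
length-topColourAt t ((J , d) ∷ ch) with t ∈ᵢ? J
... | yes _ = ≤-refl
... | no _  = length-topColourAt t ch

length-topColoursAt : ∀ t C → length (topColoursAt t C) ≤ length C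
length-topColoursAt t []       = z≤n
length-topColoursAt t (ch ∷ C) = begin
  length (topColourAt t ch ++ topColoursAt t C)         ≡⟨ length-++ (topColourAt t ch) ⟩
  length (topColourAt t ch) + length (topColoursAt t C) ≤⟨ +-mono-≤ (length-topColourAt t ch) (length-topColoursAt t C) ⟩
  suc (length C)                                        ∎
  where open ≤-Reasoning

module _ {t k : ℕ} (pre post : List Chain) where

  topColoursAt-mid : ∀ {ch} → k ∈ topColourAt t ch → k ∈ topColoursAt t (pre ++ ch ∷ post)
  topColoursAt-mid {ch} k∈ rewrite concatMap-++ (topColourAt t) pre (ch ∷ post) =
    ∈-++⁺ʳ (topColoursAt t pre) (∈-++⁺ˡ k∈)

  topColoursAt-∷ : ∀ x ch → k ∈ topColoursAt t (pre ++ ch ∷ post) →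
                   k ∈ topColoursAt t (pre ++ (x ∷ ch) ∷ post) ⊎ (t ∈ᵢ proj₁ x × k ∈ topColourAt t ch)
  topColoursAt-∷ (K , col) ch k∈ rewrite concatMap-++ (topColourAt t) pre (ch ∷ post)
                                       | concatMap-++ (topColourAt t) pre ((((K , col) ∷ ch)) ∷ post)
    with ∈-++⁻ (topColoursAt t pre) k∈
  ... | inj₁ k∈pre = inj₁ (∈-++⁺ˡ k∈pre)
  ... | inj₂ k∈rest with ∈-++⁻ (topColourAt t ch) k∈rest
  ...   | inj₂ k∈post = inj₁ (∈-++⁺ʳ (topColoursAt t pre) (∈-++⁺ʳ (topColourAt t ((K , col) ∷ ch)) k∈post))
  ...   | inj₁ k∈ch with t ∈ᵢ? K
  ...     | yes t∈K = inj₂ (t∈K , k∈ch)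
  ...     | no _    = inj₁ (∈-++⁺ʳ (topColoursAt t pre) (∈-++⁺ˡ k∈ch))

topColoursAt-∷ʳ : ∀ {t k} C ch → k ∈ topColoursAt t C → k ∈ topColoursAt t (C ++ ch ∷ [])
topColoursAt-∷ʳ {t} C ch k∈ rewrite concatMap-++ (topColourAt t) C (ch ∷ []) = ∈-++⁺ˡ k∈

colourDepth-chain : ∀ {t d} pre post ch → All (λ e → t ∈ᵢ proj₁ e) ch →
                    countCol d ch ≤ colourDepth d t (pre ++ ch ∷ post)
colourDepth-chain {t} {d} pre post ch t∈ch = begin
  countCol d ch                                                  ≤⟨ length-filter-mono _ Q? ch
                                                                      (λ e∈ d≡ → All.lookup t∈ch e∈ , d≡) ⟩
  length (filter Q? ch)                                          ≤⟨ m≤m+n _ _ ⟩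
  length (filter Q? ch) + length (filter Q? (concat post))       ≡⟨ sym (length-filter-++ Q? ch (concat post)) ⟩
  length (filter Q? (concat (ch ∷ post)))                        ≤⟨ m≤n+m _ _ ⟩
  length (filter Q? (concat pre)) + length (filter Q? (concat (ch ∷ post)))
                                                                 ≡⟨ sym (length-filter-++ Q? (concat pre) _) ⟩
  length (filter Q? (concat pre ++ concat (ch ∷ post)))          ≡⟨ cong (length ∘ filter Q?) (concat-++ pre (ch ∷ post)) ⟩
  colourDepth d t (pre ++ ch ∷ post)                             ∎
  where
  open ≤-Reasoning
  Q? = λ (e : Entry) → (t ∈ᵢ? proj₁ e) ×-dec (proj₂ e ≟ d)

record Inserts (C C′ : List Chain) (x : Entry) : Set where
  constructor inserts
  field entries↭ : concat C′ ↭ x ∷ concat C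

inserts-new : ∀ C x → Inserts C (C ++ (x ∷ []) ∷ []) x
inserts-new C x = inserts $ ↭-trans (↭-reflexive (sym (concat-++ C ((x ∷ []) ∷ [])))) (↭.++-comm (concat C) (x ∷ []))

inserts-∷ : ∀ pre post x ch → Inserts (pre ++ ch ∷ post) (pre ++ (x ∷ ch) ∷ post) x
inserts-∷ pre post x ch = inserts $ begin
  concat (pre ++ (x ∷ ch) ∷ post)       ≡⟨ sym (concat-++ pre ((x ∷ ch) ∷ post)) ⟩
  concat pre ++ x ∷ ch ++ concat post   ↭⟨ ↭.shift x (concat pre) (ch ++ concat post) ⟩
  x ∷ concat pre ++ concat (ch ∷ post)  ≡⟨ cong (x ∷_) (concat-++ pre (ch ∷ post)) ⟩
  x ∷ concat (pre ++ ch ∷ post)         ∎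
  where open PermutationReasoning

module _ {C C′ : List Chain} {x : Entry} (C⊕x : Inserts C C′ x) where
  open Inserts C⊕x

  inserted-∈ : x ∈ concat C′
  inserted-∈ = ∈-resp-↭ (↭-sym entries↭) (here refl)

  inserts-∈⁺ : ∀ {e} → e ∈ concat C → e ∈ concat C′
  inserts-∈⁺ e∈ = ∈-resp-↭ (↭-sym entries↭) (there e∈)

  inserts-∈⁻ : ∀ {e} → e ∈ concat C′ → e ≡ x ⊎ e ∈ concat C
  inserts-∈⁻ e∈ with ∈-resp-↭ entries↭ e∈
  ... | here e≡x  = inj₁ e≡x
  ... | there e∈C = inj₂ e∈C

  inserts-count : {Q : Entry → Set} (Q? : Decidable Q) →
                  length (filter Q? (concat C′)) ≡ indicator (Q? x) + length (filter Q? (concat C))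
  inserts-count Q? = trans (↭-length (↭.filter-↭ Q? entries↭)) (length-filter-∷ Q? x (concat C))

  colourDepth-inserts : ∀ k t → colourDepth k t C ≤ colourDepth k t C′
  colourDepth-inserts k t = subst (colourDepth k t C ≤_)
    (sym (inserts-count (λ e → (t ∈ᵢ? proj₁ e) ×-dec (proj₂ e ≟ k)))) (m≤n+m _ _)

lookup-∷ʳ : ∀ {χ} (D : Vec ℕ χ) x (d : Fin (suc χ)) →
            (toℕ d ≡ χ × Vec.lookup (D Vec.∷ʳ x) d ≡ x) ⊎
            (∃ λ d′ → toℕ d ≡ toℕ d′ × Vec.lookup (D Vec.∷ʳ x) d ≡ Vec.lookup D d′)
lookup-∷ʳ []       x Fin.zero    = inj₁ (refl , refl)
lookup-∷ʳ (y ∷ D) x Fin.zero    = inj₂ (Fin.zero , refl , refl)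
lookup-∷ʳ (y ∷ D) x (Fin.suc d) with lookup-∷ʳ D x d
... | inj₁ (d≡χ , v≡x)         = inj₁ (cong suc d≡χ , v≡x)
... | inj₂ (d′ , d≡d′ , v≡Dd′) = inj₂ (Fin.suc d′ , cong suc d≡d′ , v≡Dd′)

bottomB-lookup : ∀ {J χ D χ′ D′ col} → BottomB J χ D χ′ D′ col → ∀ (d : Fin χ′) →
                 (toℕ d ≡ col × Vec.lookup D′ d ≡ right J) ⊎
                 (∃ λ d′ → toℕ d ≡ toℕ d′ × Vec.lookup D′ d ≡ Vec.lookup D d′)
bottomB-lookup {J} {D = D} (fresh _) d = lookup-∷ʳ D (right J) d
bottomB-lookup {J} {D = D} (reuse d₀ _) d with d Fin.≟ d₀
... | yes refl = inj₁ (refl , lookup∘update d₀ D (right J))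
... | no d≢d₀  = inj₂ (d , refl , lookup∘update′ d≢d₀ D (right J))

bottomB-fresh : ∀ {J χ D χ′ D′ col} → left J < right J → BottomB J χ D χ′ D′ col →
                χ′ ≡ χ ⊎ (∀ d → left J ≤ Vec.lookup D′ d)
bottomB-fresh lJ<rJ (reuse _ _) = inj₁ refl
bottomB-fresh {J} {D = D} lJ<rJ (fresh allBusy) = inj₂ λ d → case (lookup-∷ʳ D (right J) d)
  where
  case : ∀ {d} → _ → left J ≤ Vec.lookup (D Vec.∷ʳ right J) d
  case (inj₁ (_ , v≡rJ))     = subst (left J ≤_) (sym v≡rJ) (<⇒≤ lJ<rJ)
  case (inj₂ (d′ , _ , v≡Dd′)) = subst (left J ≤_) (sym v≡Dd′) (≮⇒≥ (allBusy d′))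

-- Algorithm B

module AlgorithmB {n : ℕ} (I : Fin n → Interval) (valid : ValidInstance I)
                  (h : ℕ) {c : ℕ} (f : Fin n → Fin c) (part : IsChainPartition I f) where
  open Instance I valid
  open ChainPartition f part

  IsTopIn : List (Fin n) → Fin n → Set
  IsTopIn P z = All (λ z′ → ¬ z′ ⊏ z) P

  isTopIn? : ∀ P → Decidable (IsTopIn P)
  isTopIn? P z = All.all? (λ z′ → ¬? (z′ ⊏? z)) P

  partitionTopsBy : List (Fin n) → ℕ → ℕ
  partitionTopsBy P r = length (filter (λ z → isTopIn? P z ×-dec (right (I z) ≤? r)) P)

  length-tops≤c : ∀ {P} → Unique P → length (filter (isTopIn? P) P) ≤ c
  length-tops≤c {P} P! = begin
    length tops              ≡⟨ sym (length-map f tops) ⟩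
    length (map f tops)      ≤⟨ Unique-⊆⇒length≤ (map⁺-injectiveOn f one-top-per-chain (Unique.filter⁺ _ P!))
                                                  (λ _ → ∈-allFin _) ⟩
    length (allFin c)        ≡⟨ length-tabulate {n = c} id ⟩
    c                        ∎
    where
    open ≤-Reasoning
    tops = filter (isTopIn? P) P
    one-top-per-chain : ∀ {z z′} → z ∈ tops → z′ ∈ tops → f z ≡ f z′ → z ≡ z′
    one-top-per-chain {z} {z′} z∈ z′∈ fz≡fz′ with z Fin.≟ z′
    ... | yes z≡z′ = z≡z′
    ... | no z≢z′ with ∈-filter⁻ (isTopIn? P) {xs = P} z∈ | ∈-filter⁻ (isTopIn? P) {xs = P} z′∈
    ...   | z∈P , z-top | z′∈P , z′-top with sameChain⇒⊏⊎⊐ z≢z′ fz≡fz′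
    ...     | inj₁ z⊏z′ = ⊥-elim (All.lookup z′-top z∈P z⊏z′)
    ...     | inj₂ z′⊏z = ⊥-elim (All.lookup z-top z′∈P z′⊏z)

  Earlier : Fin n → Fin n → Set
  Earlier i j = left (I i) < left (I j)

  -- P lists the processed indices (most recent first), js the pending ones.
  record Bookkeeping (C : List Chain) (P js : List (Fin n)) : Set where
    field
      entry-processed   : ∀ {e} → e ∈ concat C → ∃ λ j → j ∈ P × proj₁ e ≡ I j
      entryDepth≤       : ∀ t → entryDepth t C ≤ length (filter (λ j → t ∈ᵢ? I j) P)
      processed-unique  : Unique P
      processed-earlier : All (λ i → All (Earlier i) js) P
      pending-sorted    : AllPairs Earlier js

  open Bookkeeping

  entryDepth≤depth : ∀ {C P js} → Bookkeeping C P js → ∀ t → entryDepth t C ≤ depth I t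
  entryDepth≤depth {P = P} bk t = ≤-trans (entryDepth≤ bk t)
    (Unique-⊆⇒length≤ (Unique.filter⁺ _ (processed-unique bk))
      (λ j∈ → ∈-filter⁺ (λ j → t ∈ᵢ? I j) (∈-allFin _) (proj₂ (∈-filter⁻ (λ j → t ∈ᵢ? I j) {xs = P} j∈))))

  StartedBy : List Chain → ℕ → Set
  StartedBy C t = ∀ {e} → e ∈ concat C → left (proj₁ e) ≤ t

  module _ {C P j js} (bk : Bookkeeping C P (j ∷ js)) where

    entry-earlier : ∀ {e} → e ∈ concat C → left (proj₁ e) < left (I j)
    entry-earlier e∈ with entry-processed bk e∈
    ... | i , i∈P , refl = All.head (All.lookup (processed-earlier bk) i∈P)

    bookkeeping-step : ∀ {C′ col} → Inserts C C′ (I j , col) → Bookkeeping C′ (j ∷ P) js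
    bookkeeping-step {C′} C⊕x = record
      { entry-processed   = processed
      ; entryDepth≤       = λ t → subst₂ _≤_
          (sym (inserts-count C⊕x (λ e → t ∈ᵢ? proj₁ e)))
          (sym (length-filter-∷ (λ i → t ∈ᵢ? I i) j P))
          (+-monoʳ-≤ (indicator (t ∈ᵢ? I j)) (entryDepth≤ bk t))
      ; processed-unique  = All.tabulate (λ i∈P j≡i → <-irrefl (cong (left ∘ I) (sym j≡i))
                                                        (All.head (All.lookup (processed-earlier bk) i∈P)))
                          ∷ processed-unique bk
      ; processed-earlier = AllPairs.head (pending-sorted bk) ∷ All.map All.tail (processed-earlier bk)
      ; pending-sorted    = AllPairs.tail (pending-sorted bk)
      }
      where
      processed : ∀ {e} → e ∈ concat C′ → ∃ λ i → i ∈ j ∷ P × proj₁ e ≡ I i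
      processed e∈ with inserts-∈⁻ C⊕x e∈
      ... | inj₁ refl = j , here refl , refl
      ... | inj₂ e∈C  = let i , i∈P , e≡ = entry-processed bk e∈C in i , there i∈P , e≡

    started-at-current : ∀ {C′ col} → Inserts C C′ (I j , col) → StartedBy C′ (left (I j))
    started-at-current C⊕x e∈ with inserts-∈⁻ C⊕x e∈
    ... | inj₁ refl = ≤-refl
    ... | inj₂ e∈C  = <⇒≤ (entry-earlier e∈C)

    -- The top starts before I j, so not containing I j means ending before it.
    topRight<-new : ∀ {ch} → ch ∈ C → ¬ TopContains (I j) ch → topRight ch < right (I j)
    topRight<-new {[]}          _   _      = ≤-<-trans z≤n (proj₁ valid j)
    topRight<-new {(T , _) ∷ _} ch∈ ¬Ij⊆T =
      ≰⇒> (λ rj≤rT → ¬Ij⊆T (<⇒≤ (entry-earlier (∈-concat⁺′ (here refl) ch∈)) , rj≤rT))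

    -- Every chain ending by r < right J ends before I j: otherwise it would contain
    -- I j and end before J, contradicting the choice of J.
    chainTopsBy-below : ∀ pre post {J d₀ rest} r → All (TopRightAtLeast (right J) (I j)) (pre ++ post) →
      C ≡ pre ++ ((J , d₀) ∷ rest) ∷ post → ¬ right J ≤ r → chainTopsBy C r ≤ chainTopsBy C (right (I j))
    chainTopsBy-below pre post {J} {d₀} {rest} r best refl rJ≰r = length-filter-mono _ _ C ends-before
      where
      other : ∀ {ch} → ch ∈ C → TopRightAtLeast (right J) (I j) ch → topRight ch ≤ r → topRight ch ≤ right (I j)
      other {[]}          _   _     _       = z≤n
      other {(T , _) ∷ _} ch∈ best-T rT≤r with right (I j) ≤? right T
      ... | yes rj≤rT = ⊥-elim (rJ≰r (≤-trans (best-T (<⇒≤ (entry-earlier (∈-concat⁺′ (here refl) ch∈)) , rj≤rT)) rT≤r))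
      ... | no rj≰rT  = <⇒≤ (≰⇒> rj≰rT)
      ends-before : ∀ {ch} → ch ∈ C → topRight ch ≤ r → topRight ch ≤ right (I j)
      ends-before ch∈ rT≤r with ∈-++⁻ pre ch∈
      ... | inj₁ ch∈pre           = other ch∈ (All.lookup best (∈-++⁺ˡ ch∈pre)) rT≤r
      ... | inj₂ (here refl)      = ⊥-elim (rJ≰r rT≤r)
      ... | inj₂ (there ch∈post) = other ch∈ (All.lookup best (∈-++⁺ʳ pre ch∈post)) rT≤r

  -- Adding the latest interval j to the processed set P, the partition loses at
  -- most one top: the top of j's chain, if that chain's intervals in P contain j.
  module _ {P j} (P! : Unique P) (j-latest : All (λ i → Earlier i j) P) where

    current-isTop : IsTopIn (j ∷ P) j
    current-isTop = ⊏-irrefl ∷ All.map (λ i<j (_ , lj<li , _) → <-asym lj<li i<j) j-latest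

    remainingTopsBy : ℕ → ℕ
    remainingTopsBy r = length (filter (λ z → isTopIn? (j ∷ P) z ×-dec (right (I z) ≤? r)) P)

    partitionTopsBy-∷ : ∀ r → partitionTopsBy (j ∷ P) r ≡ indicator (right (I j) ≤? r) + remainingTopsBy r
    partitionTopsBy-∷ r =
      trans (length-filter-∷ (λ z → isTopIn? (j ∷ P) z ×-dec (right (I z) ≤? r)) j P)
            (cong (_+ remainingTopsBy r) (indicator-×-yesˡ (isTopIn? (j ∷ P) j) current-isTop (right (I j) ≤? r)))

    tops-kept : (∀ {z} → z ∈ P → IsTopIn P z → ¬ j ⊏ z) → ∀ r → partitionTopsBy P r ≤ remainingTopsBy r
    tops-kept none r = length-filter-mono _ _ P
      (λ z∈P (z-top , rz≤r) → (none z∈P z-top ∷ z-top) , rz≤r)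

    module _ {x} (x∈P : x ∈ P) (x-top : IsTopIn P x) (j⊏x : j ⊏ x) where

      tops-lost : ∀ r → partitionTopsBy P r ≤ remainingTopsBy r + indicator (right (I x) ≤? r)
      tops-lost r = begin
        partitionTopsBy P r                                    ≤⟨ only-x-lost ⟩
        remainingTopsBy r + indicator (isTopIn? P x ×-dec (right (I x) ≤? r))
                                                               ≡⟨ cong (remainingTopsBy r +_)
                                                                    (indicator-×-yesˡ (isTopIn? P x) x-top (right (I x) ≤? r)) ⟩
        remainingTopsBy r + indicator (right (I x) ≤? r)       ∎
        where
        open ≤-Reasoning
        only-x-lost = length-filter≤filter+indicator _ _ x P! λ {z} z∈P (z-top , rz≤r) → case z∈P z-top rz≤r
          where
          case : ∀ {z} → z ∈ P → IsTopIn P z → right (I z) ≤ r →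
                 (IsTopIn (j ∷ P) z × right (I z) ≤ r) ⊎ z ≡ x
          case {z} z∈P z-top rz≤r with j ⊏? z
          ... | no ¬j⊏z = inj₁ ((¬j⊏z ∷ z-top) , rz≤r)
          ... | yes j⊏z with z Fin.≟ x
          ...   | yes z≡x = inj₂ z≡x
          ...   | no z≢x with sameChain⇒⊏⊎⊐ z≢x (trans (proj₁ j⊏z) (sym (proj₁ j⊏x)))
          ...     | inj₁ z⊏x = ⊥-elim (All.lookup x-top z∈P z⊏x)
          ...     | inj₂ x⊏z = ⊥-elim (All.lookup z-top x∈P x⊏z)

      tops-grow : ∀ r → right (I x) ≤ r → partitionTopsBy P (right (I j)) < partitionTopsBy P r
      tops-grow r rx≤r = length-filter-mono-< _ _ P
        (λ _ (z-top , rz≤rj) → z-top , ≤-trans rz≤rj (≤-trans (<⇒≤ (proj₂ (proj₂ j⊏x))) rx≤r))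
        x∈P (x-top , rx≤r) (λ (_ , rx≤rj) → <⇒≱ (proj₂ (proj₂ j⊏x)) rx≤rj)

    -- b r counts the chain tops ending by r before the step and m after it: either
    -- a top ending by r was covered, or nothing was and j ends after all of them.
    dominance-step : (b : ℕ → ℕ) → (∀ r → b r ≤ partitionTopsBy P r) → ∀ {m} r →
      suc m ≡ b r + indicator (right (I j) ≤? r) ⊎ (m ≡ b r + indicator (right (I j) ≤? r) × b r ≤ b (right (I j))) →
      m ≤ partitionTopsBy (j ∷ P) r
    dominance-step b b≤tops {m} r change =
      subst (m ≤_) (trans (+-comm (remainingTopsBy r) ir) (sym (partitionTopsBy-∷ r))) (m≤remaining+ir change)
      where
      open ≤-Reasoning
      ir = indicator (right (I j) ≤? r)
      lost-one : ∀ {x} → x ∈ P → IsTopIn P x → j ⊏ x → right (I x) ≤ r →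
                 partitionTopsBy P r ≤ suc (remainingTopsBy r)
      lost-one x∈P x-top j⊏x rx≤r = subst (partitionTopsBy P r ≤_)
        (trans (cong (remainingTopsBy r +_) (indicator-yes (right (I _) ≤? r) rx≤r)) (+-comm _ 1))
        (tops-lost x∈P x-top j⊏x r)
      Change = suc m ≡ b r + ir ⊎ (m ≡ b r + ir × b r ≤ b (right (I j)))
      m≤b+ir : Change → m ≤ b r + ir
      m≤b+ir (inj₁ 1+m≡)     = ≤-trans (n≤1+n m) (≤-reflexive 1+m≡)
      m≤b+ir (inj₂ (m≡ , _)) = ≤-reflexive m≡
      from-kept : Change → partitionTopsBy P r ≤ remainingTopsBy r → m ≤ remainingTopsBy r + ir
      from-kept ch kept = ≤-trans (m≤b+ir ch) (+-monoˡ-≤ ir (≤-trans (b≤tops r) kept))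
      m≤remaining+ir : Change → m ≤ remainingTopsBy r + ir
      m≤remaining+ir ch with Any.any? (λ z → isTopIn? P z ×-dec (j ⊏? z)) P
      ... | no none = from-kept ch (tops-kept (λ z∈P z-top j⊏z → none (lose z∈P (z-top , j⊏z))) r)
      ... | yes some with find some
      ...   | x , x∈P , x-top , j⊏x with right (I x) ≤? r
      ...     | no rx≰r = from-kept ch (subst (partitionTopsBy P r ≤_)
                  (trans (cong (remainingTopsBy r +_) (indicator-no (right (I x) ≤? r) rx≰r)) (+-identityʳ _))
                  (tops-lost x∈P x-top j⊏x r))
      ...     | yes rx≤r with ch
      ...       | inj₁ 1+m≡ = ≤-pred (begin
                  suc m                              ≡⟨ 1+m≡ ⟩
                  b r + ir                           ≤⟨ +-monoˡ-≤ ir (≤-trans (b≤tops r) (lost-one x∈P x-top j⊏x rx≤r)) ⟩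
                  suc (remainingTopsBy r) + ir       ∎)
      ...       | inj₂ (m≡ , br≤brj) = begin
                  m                                  ≡⟨ m≡ ⟩
                  b r + ir                           ≤⟨ +-monoˡ-≤ ir (≤-pred (begin
                    suc (b r)                          ≤⟨ s≤s (≤-trans br≤brj (b≤tops (right (I j)))) ⟩
                    suc (partitionTopsBy P (right (I j))) ≤⟨ tops-grow x∈P x-top j⊏x r rx≤r ⟩
                    partitionTopsBy P r                ≤⟨ lost-one x∈P x-top j⊏x rx≤r ⟩
                    suc (remainingTopsBy r)            ∎)) ⟩
                  remainingTopsBy r + ir             ∎

  Blocked : List Chain → ℕ → ℕ → Set
  Blocked C t k = h ≤ colourDepth k t C ⊎ k ∈ topColoursAt t C

  -- D d is the right end of the last bottom of colour d; for t ≤ D d that bottom contains t.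
  ColoursBlocked : List Chain → (χ : ℕ) → Vec ℕ χ → Set
  ColoursBlocked C χ D = ∀ t → StartedBy C t → ∀ d → t ≤ Vec.lookup D d → Blocked C t (toℕ d)

  blocked-new : ∀ {C t k} x → Blocked C t k → Blocked (C ++ (x ∷ []) ∷ []) t k
  blocked-new {C} {t} {k} x (inj₁ deep) = inj₁ (≤-trans deep (colourDepth-inserts (inserts-new C x) k t))
  blocked-new {C}         x (inj₂ top)  = inj₂ (topColoursAt-∷ʳ C (x ∷ []) top)

  blocked-∷ : ∀ {t k} pre post {K col J d₀ rest} → Descending ((J , d₀) ∷ rest) → K ⊆ᵢ J →
              col ≡ d₀ ⊎ h ≤ countCol d₀ ((J , d₀) ∷ rest) →
              Blocked (pre ++ ((J , d₀) ∷ rest) ∷ post) t k →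
              Blocked (pre ++ ((K , col) ∷ (J , d₀) ∷ rest) ∷ post) t k
  blocked-∷ {t} {k} pre post {K} {col} {J} {d₀} {rest} _ _ _ (inj₁ deep) =
    inj₁ (≤-trans deep (colourDepth-inserts (inserts-∷ pre post (K , col) ((J , d₀) ∷ rest)) k t))
  blocked-∷ {t} {k} pre post {K} {col} {J} {d₀} {rest} desc K⊆J kept-or-full (inj₂ top)
    with topColoursAt-∷ pre post (K , col) ((J , d₀) ∷ rest) top
  ... | inj₁ top′ = inj₂ top′
  ... | inj₂ (t∈K , k∈) with subst (k ∈_) (topColourAt-∈ᵢ d₀ rest (∈ᵢ-⊆ᵢ t∈K K⊆J)) k∈ | kept-or-full
  ...   | here refl | inj₁ refl =
    inj₂ (topColoursAt-mid pre post (subst (k ∈_) (sym (topColourAt-∈ᵢ col ((J , d₀) ∷ rest) t∈K)) (here refl)))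
  ...   | here refl | inj₂ full = inj₁ (begin
    h                                                    ≤⟨ full ⟩
    countCol k ((J , d₀) ∷ rest)                         ≤⟨ colourDepth-chain pre post _ (descending⇒∈ᵢ desc (∈ᵢ-⊆ᵢ t∈K K⊆J)) ⟩
    colourDepth k t (pre ++ ((J , d₀) ∷ rest) ∷ post)    ≤⟨ colourDepth-inserts (inserts-∷ pre post (K , col) _) k t ⟩
    colourDepth k t (pre ++ ((K , col) ∷ (J , d₀) ∷ rest) ∷ post) ∎)
    where open ≤-Reasoning

  module _ {C C′ J col} (C⊕J : Inserts C C′ (J , col)) (transfer : ∀ {t k} → Blocked C t k → Blocked C′ t k) where

    private
      started-before : ∀ {t} → StartedBy C′ t → StartedBy C t
      started-before started e∈ = started (inserts-∈⁺ C⊕J e∈)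

    coloursBlocked-keep : ∀ {χ D} → ColoursBlocked C χ D → ColoursBlocked C′ χ D
    coloursBlocked-keep blocked t started d t≤Dd = transfer (blocked t (started-before started) d t≤Dd)

    coloursBlocked-bottom : ∀ {χ D χ′ D′} → ColoursBlocked C χ D → (∀ {t} → t ∈ᵢ J → col ∈ topColoursAt t C′) →
                            BottomB J χ D χ′ D′ col → ColoursBlocked C′ χ′ D′
    coloursBlocked-bottom blocked J-top bottom t started d t≤D′d with bottomB-lookup bottom d
    ... | inj₁ (d≡col , D′d≡rJ) =
      inj₂ (subst (_∈ topColoursAt t C′) (sym d≡col) (J-top (started (inserted-∈ C⊕J) , subst (t ≤_) D′d≡rJ t≤D′d)))
    ... | inj₂ (d′ , d≡d′ , D′d≡Dd′) =
      subst (Blocked C′ t) (sym d≡d′) (transfer (blocked t (started-before started) d′ (subst (t ≤_) D′d≡Dd′ t≤D′d)))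

  module _ {C P js} (bk : Bookkeeping C P js) (dominated : ∀ r → chainTopsBy C r ≤ partitionTopsBy P r) where

    length-chains≤c : length C ≤ c
    length-chains≤c = begin
      length C                           ≡⟨ cong length (sym (filter-all (λ ch → topRight ch ≤? R) (All.tabulate topRight≤R))) ⟩
      chainTopsBy C R                    ≤⟨ dominated R ⟩
      partitionTopsBy P R                ≤⟨ length-filter-mono _ (isTopIn? P) P (λ _ → proj₁) ⟩
      length (filter (isTopIn? P) P)     ≤⟨ length-tops≤c (processed-unique bk) ⟩
      c                                  ∎
      where
      open ≤-Reasoning
      R = sum (map (right ∘ I) (allFin n))
      topRight≤R : ∀ {ch} → ch ∈ C → topRight ch ≤ R
      topRight≤R {[]}    _   = z≤n
      topRight≤R {_ ∷ _} ch∈ with entry-processed bk (∈-concat⁺′ (here refl) ch∈)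
      ... | j , _ , refl = ∈⇒≤sum (∈-map⁺ (right ∘ I) (∈-allFin j))

    h*χ≤depth+h*c : ∀ {χ} t → (∀ (d : Fin χ) → Blocked C t (toℕ d)) → h * χ ≤ depth I t + h * c
    h*χ≤depth+h*c {χ} t blocked = begin
      h * χ                                     ≡⟨ cong (h *_) (sym (length-upTo χ)) ⟩
      h * length (upTo χ)                       ≤⟨ *-monoʳ-≤ h (length≤filter+⊆ deep? (Unique.upTo⁺ χ) top) ⟩
      h * (length deep + length (topColoursAt t C)) ≡⟨ *-distribˡ-+ h (length deep) _ ⟩
      h * length deep + h * length (topColoursAt t C)
        ≤⟨ +-mono-≤ h*deep≤depth (*-monoʳ-≤ h (≤-trans (length-topColoursAt t C) length-chains≤c)) ⟩
      depth I t + h * c                         ∎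
      where
      open ≤-Reasoning
      deep? : Decidable (λ k → h ≤ colourDepth k t C)
      deep? k = h ≤? colourDepth k t C
      deep = filter deep? (upTo χ)
      top : ∀ {k} → k ∈ upTo χ → ¬ h ≤ colourDepth k t C → k ∈ topColoursAt t C
      top {k} k∈ shallow with subst (Blocked C t) (toℕ-fromℕ< (∈-upTo⁻ k∈)) (blocked (Fin.fromℕ< (∈-upTo⁻ k∈)))
      ... | inj₁ deep-k = ⊥-elim (shallow deep-k)
      ... | inj₂ top-k  = top-k
      h*deep≤depth : h * length deep ≤ depth I t
      h*deep≤depth = begin
        h * length deep                             ≡⟨ trans (*-comm h _) (sym (sum-map-const h deep)) ⟩
        sum (map (λ _ → h) deep)                    ≤⟨ sum-map-mono _ _ deep (λ k∈ → proj₂ (∈-filter⁻ deep? {xs = upTo χ} k∈)) ⟩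
        sum (map (λ k → colourDepth k t C) deep)    ≤⟨ sum-countWithKey≤ _≟_ proj₂ (λ e → t ∈ᵢ? proj₁ e)
                                                          (Unique.filter⁺ deep? (Unique.upTo⁺ χ)) (concat C) ⟩
        entryDepth t C                              ≤⟨ entryDepth≤depth bk t ⟩
        depth I t                                   ∎

  record Invariant (C : List Chain) (χ : ℕ) (D : Vec ℕ χ) (P js : List (Fin n)) : Set where
    field
      bookkeeping    : Bookkeeping C P js
      descending     : All Descending C
      dominated      : ∀ r → chainTopsBy C r ≤ partitionTopsBy P r
      coloursBlocked : ColoursBlocked C χ D

  open Invariant

  module _ {C χ D P j js} (inv : Invariant C χ D P (j ∷ js)) where

    private
      bk = bookkeeping inv
      j-latest : All (λ i → Earlier i j) P
      j-latest = All.map All.head (processed-earlier bk)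

    dominated-new : ∀ col → (∀ {ch} → ch ∈ C → ¬ TopContains (I j) ch) →
                    ∀ r → chainTopsBy (C ++ ((I j , col) ∷ []) ∷ []) r ≤ partitionTopsBy (j ∷ P) r
    dominated-new col no-top r = dominance-step (processed-unique bk) j-latest (chainTopsBy C) (dominated inv) r
      (inj₂ (new-tops , length-filter-mono _ _ C (λ ch∈ _ → <⇒≤ (topRight<-new bk ch∈ (no-top ch∈)))))
      where
      ir = indicator (right (I j) ≤? r)
      new-tops : chainTopsBy (C ++ ((I j , col) ∷ []) ∷ []) r ≡ chainTopsBy C r + ir
      new-tops = begin
        chainTopsBy (C ++ ((I j , col) ∷ []) ∷ []) r                  ≡⟨ length-filter-insert _ C _ [] ⟩
        ir + length (filter (λ ch → topRight ch ≤? r) (C ++ []))      ≡⟨ cong (λ C₀ → ir + chainTopsBy C₀ r) (++-identityʳ C) ⟩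
        ir + chainTopsBy C r                                          ≡⟨ +-comm ir _ ⟩
        chainTopsBy C r + ir                                          ∎
        where open ≡-Reasoning

    dominated-∷ : ∀ pre post {J d₀ rest} col → C ≡ pre ++ ((J , d₀) ∷ rest) ∷ post →
                  All (TopRightAtLeast (right J) (I j)) (pre ++ post) →
                  ∀ r → chainTopsBy (pre ++ ((I j , col) ∷ (J , d₀) ∷ rest) ∷ post) r ≤ partitionTopsBy (j ∷ P) r
    dominated-∷ pre post {J} {d₀} {rest} col refl best r =
      dominance-step (processed-unique bk) j-latest (chainTopsBy C) (dominated inv) r change
      where
      open ≡-Reasoning
      ir = indicator (right (I j) ≤? r)
      others = chainTopsBy (pre ++ post) r
      new-tops : chainTopsBy (pre ++ ((I j , col) ∷ (J , d₀) ∷ rest) ∷ post) r ≡ ir + others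
      new-tops = length-filter-insert _ pre _ post
      old-tops : chainTopsBy C r ≡ indicator (right J ≤? r) + others
      old-tops = length-filter-insert _ pre _ post
      change : _
      change with right J ≤? r
      ... | yes rJ≤r = inj₁ (begin
        suc (chainTopsBy (pre ++ ((I j , col) ∷ (J , d₀) ∷ rest) ∷ post) r) ≡⟨ cong suc (trans new-tops (+-comm ir others)) ⟩
        suc others + ir                                                     ≡⟨ cong (_+ ir) (sym (trans old-tops
                                                                               (cong (_+ others) (indicator-yes (right J ≤? r) rJ≤r)))) ⟩
        chainTopsBy C r + ir                                                ∎)
      ... | no rJ≰r = inj₂ ((begin
        chainTopsBy (pre ++ ((I j , col) ∷ (J , d₀) ∷ rest) ∷ post) r       ≡⟨ trans new-tops (+-comm ir others) ⟩
        others + ir                                                         ≡⟨ cong (_+ ir) (sym (trans old-tops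
                                                                               (cong (_+ others) (indicator-no (right J ≤? r) rJ≰r)))) ⟩
        chainTopsBy C r + ir                                                ∎) ,
        chainTopsBy-below bk pre post r best refl rJ≰r)

  module _ {ω : ℕ} (depth≤ω : ∀ t → depth I t ≤ ω) where

    Bounded : ℕ → Set
    Bounded χ = h * χ ≤ ω + h * c

    bottom-bounded : ∀ {C C′ χ D χ′ D′ P j js col} → Bookkeeping C P (j ∷ js) → Inserts C C′ (I j , col) →
                     Invariant C′ χ′ D′ (j ∷ P) js → BottomB (I j) χ D χ′ D′ col → Bounded χ → Bounded χ′
    bottom-bounded {j = j} bk C⊕x inv′ bottom bounded with bottomB-fresh (proj₁ valid j) bottom
    ... | inj₁ refl = bounded
    ... | inj₂ t≤D′ = ≤-trans
      (h*χ≤depth+h*c (bookkeeping inv′) (dominated inv′) t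
        (λ d → coloursBlocked inv′ t (started-at-current bk C⊕x) d (t≤D′ d)))
      (+-monoˡ-≤ (h * c) (depth≤ω t))
      where t = left (I j)

    step-invariant : ∀ {C χ D C′ χ′ D′ P j js} → StepB h (st C χ D) (I j) (st C′ χ′ D′) →
                     Invariant C χ D P (j ∷ js) → Invariant C′ χ′ D′ (j ∷ P) js × (Bounded χ → Bounded χ′)
    step-invariant {C} {j = j} (new {col = col} no-top bottom) inv =
      inv′ , bottom-bounded (bookkeeping inv) C⊕x inv′ bottom
      where
      C⊕x = inserts-new C (I j , col)
      inv′ = record
        { bookkeeping    = bookkeeping-step (bookkeeping inv) C⊕x
        ; descending     = AllP.++⁺ (descending inv) (([] ∷ []) ∷ [])
        ; dominated      = dominated-new inv col no-top
        ; coloursBlocked = coloursBlocked-bottom C⊕x (blocked-new {C} (I j , col)) (coloursBlocked inv)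
            (λ t∈Ij → topColoursAt-mid C [] (subst (col ∈_) (sym (topColourAt-∈ᵢ col [] t∈Ij)) (here refl)))
            bottom
        }
    step-invariant {χ = χ} {D} {j = j} (extKeep {pre} {post} {J} {d₀} {rest} Ij⊆J best _) inv = inv′ , id
      where
      C⊕x = inserts-∷ pre post (I j , d₀) ((J , d₀) ∷ rest)
      inv′ = record
        { bookkeeping    = bookkeeping-step (bookkeeping inv) C⊕x
        ; descending     = descending-insert pre post (descending inv) Ij⊆J
        ; dominated      = dominated-∷ inv pre post d₀ refl best
        ; coloursBlocked = coloursBlocked-keep C⊕x
            (blocked-∷ pre post (All.lookup (descending inv) (∈-++⁺ʳ pre (here refl))) Ij⊆J (inj₁ refl))
            {χ} {D} (coloursBlocked inv)
        }
    step-invariant {j = j} (extNew {pre} {post} {J} {d₀} {rest} {col = col} Ij⊆J best full bottom) inv =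
      inv′ , bottom-bounded (bookkeeping inv) C⊕x inv′ bottom
      where
      C⊕x = inserts-∷ pre post (I j , col) ((J , d₀) ∷ rest)
      inv′ = record
        { bookkeeping    = bookkeeping-step (bookkeeping inv) C⊕x
        ; descending     = descending-insert pre post (descending inv) Ij⊆J
        ; dominated      = dominated-∷ inv pre post col refl best
        ; coloursBlocked = coloursBlocked-bottom C⊕x
            (blocked-∷ pre post (All.lookup (descending inv) (∈-++⁺ʳ pre (here refl))) Ij⊆J (inj₂ full))
            (coloursBlocked inv)
            (λ t∈Ij → topColoursAt-mid pre post (subst (col ∈_) (sym (topColourAt-∈ᵢ col _ t∈Ij)) (here refl)))
            bottom
        }

    run-bounded : ∀ {C χ D P js s} → RunsB h (st C χ D) (map I js) s → Invariant C χ D P js →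
                  Bounded χ → Bounded (StateB.χ s)
    run-bounded {js = []}    done                                 _   bounded = bounded
    run-bounded {js = _ ∷ _} (step {s' = st _ _ _} first rest) inv bounded =
      let inv′ , bounded′ = step-invariant first inv in run-bounded rest inv′ (bounded′ bounded)

    runB-bounded : SortedByStart I → ∀ {χ} → RunB h I χ → Bounded χ
    runB-bounded sorted (s , run , refl) =
      run-bounded (subst (λ Is → RunsB h (st [] 0 []) Is s) (sym (map-tabulate id I)) run) (record
        { bookkeeping    = record
          { entry-processed   = λ ()
          ; entryDepth≤       = λ _ → z≤n
          ; processed-unique  = []
          ; processed-earlier = []
          ; pending-sorted    = AllPairsₚ.tabulate⁺-< (sorted _ _)
          }
        ; descending     = []
        ; dominated      = λ _ → z≤n
        ; coloursBlocked = λ _ _ ()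
        }) (subst (_≤ ω + h * c) (sym (*-zeroʳ h)) z≤n)

lemma2 : (n h : ℕ) (I : Fin n → Interval) → 1 ≤ h →
    ValidInstance I → SortedByStart I →
    (ω c : ℕ) → IsMaxDepth I ω → IsMinChainCount I c →
    (∀ χ → RunA h I χ → h * χ ≤ ω + h * c)
    × (∀ χ → RunB h I χ → h * χ ≤ ω + h * c)
lemma2 n h I 1≤h valid sorted ω c (_ , depth≤ω) ((f , partition) , _) = boundA , boundB
  where
  boundA : ∀ χ → RunA h I χ → h * χ ≤ ω + h * c
  boundA χ (c′ , f′ , partition′ , minimal′ , run) = begin
    h * χ       ≤⟨ AlgorithmA.runA-bounded I valid h {{>-nonZero 1≤h}} f′ partition′ depth≤ω sorted run ⟩
    ω + h * c′  ≤⟨ +-monoʳ-≤ ω (*-monoʳ-≤ h (minimal′ c f partition)) ⟩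
    ω + h * c   ∎
    where open ≤-Reasoning

  boundB : ∀ χ → RunB h I χ → h * χ ≤ ω + h * c
  boundB χ = AlgorithmB.runB-bounded I valid h f partition depth≤ω sorted
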